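{- Let $n\ge1$, $\mathbb{Z}_n=\{0,\dots,n-1\}$, and let $\mathbf{X}$ be the $n\times n$ matrix with entries $\mathbf{X}[i,j]=x^{(n+1)^{|i-j|}}$ for $i,j\in\mathbb{Z}_n$, where $x$ is an indeterminate. Define $F_{\mathbf{X}}(x)=\det\big(\operatorname{diag}(\mathbf{X}\cdot\mathbf{1}_{n\times1})\big)$. For a non-decreasing sequence $s=(s_0,\dots,s_{n-1})$ with entries in $\mathbb{Z}_n$ put $e(s)=\sum_{k=0}^{n-1}(n+1)^{s_k}$. Then distinct such sequences $s$ give distinct exponents $e(s)$, and for every such $s$ the coefficient of $x^{e(s)}$ in $F_{\mathbf{X}}(x)$ equals the number of functions $f:\mathbb{Z}_n\to\mathbb{Z}_n$ whose functional directed graph $G_f$ has induced subtractive edge label sequence $s$. In other words, $F_{\mathbf{X}}$ is the generating function whose coefficients enumerate the functional directed graphs on $\mathbb{Z}_n$ having the same induced subtractive edge label sequence.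
   Context: For $f:\mathbb{Z}_n\to\mathbb{Z}_n$, the functional directed graph $G_f$ has vertex set $\mathbb{Z}_n$ and edges $(i,f(i))$, $i\in\mathbb{Z}_n$. The induced subtractive edge label of the edge $(i,f(i))$ is $|f(i)-i|$, and the induced subtractive edge label sequence of $G_f$ is the non-decreasing rearrangement of $(|f(i)-i|)_{i\in\mathbb{Z}_n}$. $\mathbf{1}_{n\times1}$ is the all-ones column vector and $\operatorname{diag}(v)$ is the diagonal matrix with diagonal $v$. -}

module Defs where

open import Data.Nat as ℕ using (ℕ; zero; suc; _^_; ∣_-_∣)
open import Data.Nat.Properties using (≤-decTotalOrder)
open import Data.Integer as ℤ using (ℤ; +_; -_)
open import Data.Fin as Fin using (Fin; zero; suc; toℕ; punchIn; _≟_)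
open import Data.List as List using (List; []; _∷_; map; concatMap; length; filter; replicate; _++_; allFin)
open import Data.Vec as Vec using (Vec; lookup)
open import Data.Vec.Functional using () renaming (_∷_ to _∷ᶠ_)
open import Relation.Nullary using (Dec; does)
open import Data.Bool using (if_then_else_)
import Data.List.Properties as LP
import Data.List.Sort as Sort

-- Polynomials in one indeterminate x over ℤ, as coefficient lists
-- (index k = coefficient of x^k; trailing zeros allowed).

Poly : Set
Poly = List ℤ

infixl 6 _+P_
infixl 7 _*P_

_+P_ : Poly → Poly → Poly
[] +P q = q
(a ∷ p) +P [] = a ∷ p
(a ∷ p) +P (b ∷ q) = (a ℤ.+ b) ∷ (p +P q)

_*P_ : Poly → Poly → Poly
[] *P q = []
(a ∷ p) *P q = map (a ℤ.*_) q +P ((+ 0) ∷ (p *P q))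

coeff : Poly → ℕ → ℤ
coeff [] k = + 0
coeff (a ∷ p) zero = a
coeff (a ∷ p) (suc k) = coeff p k

zeroP oneP : Poly
zeroP = []
oneP = + 1 ∷ []

monomial : ℕ → Poly
monomial k = replicate k (+ 0) ++ (+ 1 ∷ [])

sumP : ∀ n → (Fin n → Poly) → Poly
sumP zero f = zeroP
sumP (suc n) f = f zero +P sumP n (λ i → f (suc i))

Matrix : ℕ → Set
Matrix n = Fin n → Fin n → Poly

sign : ℕ → Poly
sign k = (- (+ 1)) ℤ.^ k ∷ []

det : ∀ n → Matrix n → Poly
det zero M = oneP
det (suc n) M =
  sumP (suc n) (λ j → sign (toℕ j) *P (M zero j *P det n (λ r c → M (suc r) (punchIn j c))))

mulVec : ∀ {n} → Matrix n → (Fin n → Poly) → (Fin n → Poly)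
mulVec {n} M v i = sumP n (λ j → M i j *P v j)

ones : ∀ {n} → Fin n → Poly
ones _ = oneP

diag : ∀ {n} → (Fin n → Poly) → Matrix n
diag v i j = if does (i ≟ j) then v i else zeroP

Xmat : ∀ n → Matrix n
Xmat n i j = monomial ((suc n) ^ ∣ toℕ i - toℕ j ∣)

FX : ℕ → Poly
FX n = det n (diag (mulVec (Xmat n) ones))

NonDecreasing : ∀ {n} → Vec (Fin n) n → Set
NonDecreasing {n} s = ∀ (i j : Fin n) → i Fin.≤ j → lookup s i Fin.≤ lookup s j

sumℕ : ∀ n → (Fin n → ℕ) → ℕ
sumℕ zero f = 0
sumℕ (suc n) f = f zero ℕ.+ sumℕ n (λ i → f (suc i))

expo : ∀ {n} → Vec (Fin n) n → ℕ
expo {n} s = sumℕ n (λ k → (suc n) ^ toℕ (lookup s k))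

-- all functions Fin m → Fin n, each listed exactly once
allFuns : ∀ m n → List (Fin m → Fin n)
allFuns zero n = (λ ()) ∷ []
allFuns (suc m) n = concatMap (λ g → map (λ a → a ∷ᶠ g) (allFin n)) (allFuns m n)

open Sort ≤-decTotalOrder using (sort)

labelSeq : ∀ {n} → (Fin n → Fin n) → List ℕ
labelSeq {n} f = sort (map (λ i → ∣ toℕ (f i) - toℕ i ∣) (allFin n))

seqList : ∀ {n} → Vec (Fin n) n → List ℕ
seqList s = Vec.toList (Vec.map toℕ s)

countFuns : ∀ n → Vec (Fin n) n → ℕ
countFuns n s = length (filter (λ f → LP.≡-dec ℕ._≟_ (labelSeq f) (seqList s)) (allFuns n n))

module Submission where

-- Idea.  diag(X·1) is diagonal with i-th entry Σ_j x^((n+1)^|i-j|), so its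
-- determinant is the product of these row sums.  Expanding a product of sums
-- gives one monomial per function h : ℤ_n → ℤ_n, namely x^E(h) with
-- E(h) = Σ_i (n+1)^|h(i)-i|; hence the coefficient of x^k in F_X counts the h
-- with E(h) = k.  Now E(h) is the "base-(n+1) weight" Σ_k (n+1)^(s_k) of the
-- label sequence s of h, and a sorted list of at most n digits is determined
-- by its weight: the number of zeros is the weight modulo n+1 (it is ≤ n), and
-- the rest is recovered recursively from the quotient.  This gives both the
-- injectivity of e and the equivalence E(h) = e(s) ⇔ labelSeq h = s.

open import Defs
open import Data.Nat using (ℕ; _≤_)
open import Data.Integer using (+_)
open import Data.Fin using (Fin)
open import Data.Vec using (Vec)
open import Data.Product using (_×_)
open import Relation.Binary.PropositionalEquality using (_≡_)

open import Level using (0ℓ)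
open import Data.Nat as Nat using (zero; suc; _^_; _<_; z≤n; s≤s; NonZero; ∣_-_∣)
import Data.Nat.Properties as ℕP
open import Data.Nat.DivMod using (_%_; [m+kn]%n≡m%n; m<n⇒m%n≡m)
open import Data.Nat.ListAction using (sum)
open import Data.Nat.ListAction.Properties using (sum-↭)
open import Data.Integer using (ℤ)
import Data.Integer.Properties as ℤP
open import Data.Fin as Fin using (zero; suc; toℕ)
import Data.Fin.Properties as FinP
open import Data.List
  using (List; []; _∷_; map; _++_; concatMap; filter; length; replicate; tabulate; allFin)
import Data.List.Properties as ListP
open import Data.List.Relation.Unary.All using (All; []; _∷_)
import Data.List.Relation.Unary.All.Properties as AllP
open import Data.List.Relation.Unary.Linked as Linked using (Linked; []; [-]; _∷_)
open import Data.List.Relation.Unary.Linked.Properties using (Linked⇒All)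
open import Data.List.Relation.Binary.Permutation.Propositional using (_↭_; ↭-sym)
import Data.List.Relation.Binary.Permutation.Propositional.Properties as PermP
import Data.List.Sort as Sort
open import Data.Vec as Vec using ([]; _∷_; lookup)
open import Data.Vec.Functional using () renaming (_∷_ to _∷ᶠ_)
open import Data.Product using (_,_; proj₁; proj₂)
open import Relation.Binary.Bundles using (Setoid)
import Relation.Binary.Reasoning.Setoid as SetoidReasoning
open import Relation.Binary.PropositionalEquality
  using (refl; sym; trans; cong; cong₂; module ≡-Reasoning)
open import Relation.Nullary using (Dec; yes; no; ¬_)
open import Data.Empty using (⊥-elim)

open Sort ℕP.≤-decTotalOrder using (sort; sort-↭; sort-↗)

module PolynomialArithmetic where

  open import Data.Integer using (_+_; _*_)
  open import Data.Integer.Solver using (module +-*-Solver)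
  open +-*-Solver using (solve; _:+_; _:*_; _:=_)

  -- Coefficient lists may carry trailing zeros, so polynomials are compared
  -- coefficientwise.
  infix 4 _≈_
  record _≈_ (p q : Poly) : Set where
    constructor coeffwise
    field atDegree : ∀ k → coeff p k ≡ coeff q k

  open _≈_ public

  ≈-setoid : Setoid 0ℓ 0ℓ
  ≈-setoid = record
    { Carrier       = Poly
    ; _≈_           = _≈_
    ; isEquivalence = record
      { refl  = coeffwise λ _ → refl
      ; sym   = λ e → coeffwise λ k → sym (atDegree e k)
      ; trans = λ e f → coeffwise λ k → trans (atDegree e k) (atDegree f k)
      }
    }

  open Setoid ≈-setoid public
    using () renaming (refl to ≈-refl; sym to ≈-sym; trans to ≈-trans; reflexive to ≈-reflexive)

  module ≈-Reasoning = SetoidReasoning ≈-setoid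

  coeff-+P : ∀ p q k → coeff (p +P q) k ≡ coeff p k + coeff q k
  coeff-+P []      q       k       = sym (ℤP.+-identityˡ _)
  coeff-+P (a ∷ p) []      k       = sym (ℤP.+-identityʳ _)
  coeff-+P (a ∷ p) (b ∷ q) zero    = refl
  coeff-+P (a ∷ p) (b ∷ q) (suc k) = coeff-+P p q k

  +P-cong : ∀ {p p′ q q′} → p ≈ p′ → q ≈ q′ → p +P q ≈ p′ +P q′
  atDegree (+P-cong {p} {p′} {q} {q′} e f) k = begin
    coeff (p +P q) k          ≡⟨ coeff-+P p q k ⟩
    coeff p k + coeff q k     ≡⟨ cong₂ _+_ (atDegree e k) (atDegree f k) ⟩
    coeff p′ k + coeff q′ k   ≡⟨ sym (coeff-+P p′ q′ k) ⟩
    coeff (p′ +P q′) k        ∎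
    where open ≡-Reasoning

  +P-identityʳ : ∀ p → p +P zeroP ≈ p
  +P-identityʳ []      = ≈-refl
  +P-identityʳ (a ∷ p) = ≈-refl

  ∷-cong : ∀ a {p q} → p ≈ q → a ∷ p ≈ a ∷ q
  atDegree (∷-cong a e) zero = refl
  atDegree (∷-cong a e) (suc k) = atDegree e k

  coeff-0∷[] : ∀ k → coeff (+ 0 ∷ []) k ≡ + 0
  coeff-0∷[] zero    = refl
  coeff-0∷[] (suc k) = refl

  coeff-scale : ∀ a q k → coeff (map (a *_) q) k ≡ a * coeff q k
  coeff-scale a []      k       = sym (ℤP.*-zeroʳ a)
  coeff-scale a (b ∷ q) zero    = refl
  coeff-scale a (b ∷ q) (suc k) = coeff-scale a q k

  coeff-∷*P : ∀ a p q k → coeff ((a ∷ p) *P q) k ≡ a * coeff q k + coeff (+ 0 ∷ (p *P q)) k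
  coeff-∷*P a p q k =
    trans (coeff-+P (map (a *_) q) (+ 0 ∷ (p *P q)) k) (cong (_+ _) (coeff-scale a q k))

  *P-congʳ : ∀ p {q q′} → q ≈ q′ → p *P q ≈ p *P q′
  atDegree (*P-congʳ []      e) k = refl
  atDegree (*P-congʳ (a ∷ p) {q} {q′} e) k = begin
    coeff ((a ∷ p) *P q) k                        ≡⟨ coeff-∷*P a p q k ⟩
    a * coeff q k + coeff (+ 0 ∷ (p *P q)) k      ≡⟨ cong₂ (λ u v → a * u + v) (atDegree e k)
                                                           (atDegree (∷-cong (+ 0) (*P-congʳ p e)) k) ⟩
    a * coeff q′ k + coeff (+ 0 ∷ (p *P q′)) k    ≡⟨ sym (coeff-∷*P a p q′ k) ⟩
    coeff ((a ∷ p) *P q′) k                       ∎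
    where open ≡-Reasoning

  -- A polynomial whose coefficients all vanish annihilates every product;
  -- this is what makes _*P_ respect _≈_ on the left despite trailing zeros.
  *P-zeroˡ : ∀ {p} q → p ≈ zeroP → p *P q ≈ zeroP
  atDegree (*P-zeroˡ {[]}    q e) k = refl
  atDegree (*P-zeroˡ {a ∷ p} q e) k = begin
    coeff ((a ∷ p) *P q) k                       ≡⟨ coeff-∷*P a p q k ⟩
    a * coeff q k + coeff (+ 0 ∷ (p *P q)) k     ≡⟨ cong₂ (λ u v → u * coeff q k + v) (atDegree e zero)
                                                          (atDegree (∷-cong (+ 0) (*P-zeroˡ {p} q (coeffwise λ j → atDegree e (suc j)))) k) ⟩
    + 0 * coeff q k + coeff (+ 0 ∷ []) k         ≡⟨ cong (_+_ (+ 0 * coeff q k)) (coeff-0∷[] k) ⟩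
    + 0 * coeff q k + + 0                        ≡⟨ ℤP.+-identityʳ _ ⟩
    + 0                                          ∎
    where open ≡-Reasoning

  *P-zeroʳ : ∀ p → p *P zeroP ≈ zeroP
  atDegree (*P-zeroʳ []) k = refl
  atDegree (*P-zeroʳ (a ∷ p)) zero = refl
  atDegree (*P-zeroʳ (a ∷ p)) (suc k) = atDegree (*P-zeroʳ p) k

  *P-congˡ : ∀ {p p′} q → p ≈ p′ → p *P q ≈ p′ *P q
  *P-congˡ {[]}    {p′}      q e = ≈-sym (*P-zeroˡ q (≈-sym e))
  *P-congˡ {a ∷ p} {[]}      q e = *P-zeroˡ q e
  atDegree (*P-congˡ {a ∷ p} {a′ ∷ p′} q e) k = begin
    coeff ((a ∷ p) *P q) k                        ≡⟨ coeff-∷*P a p q k ⟩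
    a * coeff q k + coeff (+ 0 ∷ (p *P q)) k      ≡⟨ cong₂ (λ u v → u * coeff q k + v) (atDegree e zero)
                                                           (atDegree (∷-cong (+ 0) (*P-congˡ {p} {p′} q (coeffwise λ j → atDegree e (suc j)))) k) ⟩
    a′ * coeff q k + coeff (+ 0 ∷ (p′ *P q)) k    ≡⟨ sym (coeff-∷*P a′ p′ q k) ⟩
    coeff ((a′ ∷ p′) *P q) k                      ∎
    where open ≡-Reasoning

  *P-cong : ∀ {p p′ q q′} → p ≈ p′ → q ≈ q′ → p *P q ≈ p′ *P q′
  *P-cong {p′ = p′} {q = q} e f = ≈-trans (*P-congˡ q e) (*P-congʳ p′ f)

  regroupʳ : ∀ a b c u v → (a + b) * c + (u + v) ≡ (a * c + u) + (b * c + v)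
  regroupʳ = solve 5 (λ a b c u v → (a :+ b) :* c :+ (u :+ v) := (a :* c :+ u) :+ (b :* c :+ v)) refl

  regroupˡ : ∀ a c d u v → a * (c + d) + (u + v) ≡ (a * c + u) + (a * d + v)
  regroupˡ = solve 5 (λ a c d u v → a :* (c :+ d) :+ (u :+ v) := (a :* c :+ u) :+ (a :* d :+ v)) refl

  *P-distribʳ : ∀ q p p′ → (p +P p′) *P q ≈ p *P q +P p′ *P q
  atDegree (*P-distribʳ q []      p′) k = refl
  atDegree (*P-distribʳ q (a ∷ p) []) k = sym (trans (coeff-+P ((a ∷ p) *P q) [] k) (ℤP.+-identityʳ _))
  atDegree (*P-distribʳ q (a ∷ p) (b ∷ p′)) k = begin
    coeff (((a + b) ∷ (p +P p′)) *P q) k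
      ≡⟨ coeff-∷*P (a + b) (p +P p′) q k ⟩
    (a + b) * c + coeff (+ 0 ∷ ((p +P p′) *P q)) k
      ≡⟨ cong (_+_ ((a + b) * c)) (atDegree (∷-cong (+ 0) (*P-distribʳ q p p′)) k) ⟩
    (a + b) * c + coeff ((+ 0 ∷ (p *P q)) +P (+ 0 ∷ (p′ *P q))) k
      ≡⟨ cong (_+_ ((a + b) * c)) (coeff-+P (+ 0 ∷ (p *P q)) (+ 0 ∷ (p′ *P q)) k) ⟩
    (a + b) * c + (coeff (+ 0 ∷ (p *P q)) k + coeff (+ 0 ∷ (p′ *P q)) k)
      ≡⟨ regroupʳ a b c _ _ ⟩
    (a * c + coeff (+ 0 ∷ (p *P q)) k) + (b * c + coeff (+ 0 ∷ (p′ *P q)) k)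
      ≡⟨ cong₂ _+_ (sym (coeff-∷*P a p q k)) (sym (coeff-∷*P b p′ q k)) ⟩
    coeff ((a ∷ p) *P q) k + coeff ((b ∷ p′) *P q) k
      ≡⟨ sym (coeff-+P ((a ∷ p) *P q) ((b ∷ p′) *P q) k) ⟩
    coeff ((a ∷ p) *P q +P (b ∷ p′) *P q) k
      ∎
    where
    open ≡-Reasoning
    c : ℤ
    c = coeff q k

  *P-distribˡ : ∀ p q q′ → p *P (q +P q′) ≈ p *P q +P p *P q′
  atDegree (*P-distribˡ []      q q′) k = refl
  atDegree (*P-distribˡ (a ∷ p) q q′) k = begin
    coeff ((a ∷ p) *P (q +P q′)) k
      ≡⟨ coeff-∷*P a p (q +P q′) k ⟩
    a * coeff (q +P q′) k + coeff (+ 0 ∷ (p *P (q +P q′))) k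
      ≡⟨ cong₂ (λ u v → a * u + v) (coeff-+P q q′ k) (atDegree (∷-cong (+ 0) (*P-distribˡ p q q′)) k) ⟩
    a * (coeff q k + coeff q′ k) + coeff ((+ 0 ∷ (p *P q)) +P (+ 0 ∷ (p *P q′))) k
      ≡⟨ cong (_+_ (a * (coeff q k + coeff q′ k))) (coeff-+P (+ 0 ∷ (p *P q)) (+ 0 ∷ (p *P q′)) k) ⟩
    a * (coeff q k + coeff q′ k) + (coeff (+ 0 ∷ (p *P q)) k + coeff (+ 0 ∷ (p *P q′)) k)
      ≡⟨ regroupˡ a (coeff q k) (coeff q′ k) _ _ ⟩
    (a * coeff q k + coeff (+ 0 ∷ (p *P q)) k) + (a * coeff q′ k + coeff (+ 0 ∷ (p *P q′)) k)
      ≡⟨ cong₂ _+_ (sym (coeff-∷*P a p q k)) (sym (coeff-∷*P a p q′ k)) ⟩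
    coeff ((a ∷ p) *P q) k + coeff ((a ∷ p) *P q′) k
      ≡⟨ sym (coeff-+P ((a ∷ p) *P q) ((a ∷ p) *P q′) k) ⟩
    coeff ((a ∷ p) *P q +P (a ∷ p) *P q′) k
      ∎
    where open ≡-Reasoning

  *P-identityˡ : ∀ q → oneP *P q ≈ q
  atDegree (*P-identityˡ q) k = begin
    coeff (oneP *P q) k                     ≡⟨ coeff-∷*P (+ 1) [] q k ⟩
    + 1 * coeff q k + coeff (+ 0 ∷ []) k    ≡⟨ cong (_+_ (+ 1 * coeff q k)) (coeff-0∷[] k) ⟩
    + 1 * coeff q k + + 0                   ≡⟨ ℤP.+-identityʳ _ ⟩
    + 1 * coeff q k                         ≡⟨ ℤP.*-identityˡ _ ⟩
    coeff q k                               ∎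
    where open ≡-Reasoning

  *P-identityʳ : ∀ p → p *P oneP ≈ p
  atDegree (*P-identityʳ []) k = refl
  atDegree (*P-identityʳ (a ∷ p)) zero = trans (ℤP.+-identityʳ _) (ℤP.*-identityʳ a)
  atDegree (*P-identityʳ (a ∷ p)) (suc k) = atDegree (*P-identityʳ p) k

  x*P : ∀ p q → (+ 0 ∷ p) *P q ≈ + 0 ∷ (p *P q)
  atDegree (x*P p q) k = trans (coeff-∷*P (+ 0) p q k) (ℤP.+-identityˡ _)

  monomial-*P : ∀ a b → monomial a *P monomial b ≈ monomial (a Nat.+ b)
  monomial-*P zero    b = *P-identityˡ (monomial b)
  monomial-*P (suc a) b = ≈-trans (x*P (monomial a) (monomial b)) (∷-cong (+ 0) (monomial-*P a b))

  coeff-monomial-same : ∀ a → coeff (monomial a) a ≡ + 1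
  coeff-monomial-same zero    = refl
  coeff-monomial-same (suc a) = coeff-monomial-same a

  coeff-monomial-other : ∀ a k → ¬ a ≡ k → coeff (monomial a) k ≡ + 0
  coeff-monomial-other zero    zero    a≢k = ⊥-elim (a≢k refl)
  coeff-monomial-other zero    (suc k) a≢k = refl
  coeff-monomial-other (suc a) zero    a≢k = refl
  coeff-monomial-other (suc a) (suc k) a≢k = coeff-monomial-other a k (λ a≡k → a≢k (cong suc a≡k))

open PolynomialArithmetic

module SumsAndProducts where

  open import Data.Integer using (_+_)

  sumP-zero : ∀ n (f : Fin n → Poly) → (∀ i → f i ≈ zeroP) → sumP n f ≈ zeroP
  sumP-zero zero    f e = ≈-refl
  sumP-zero (suc n) f e = +P-cong (e zero) (sumP-zero n (λ i → f (suc i)) (λ i → e (suc i)))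

  sumP-*P : ∀ n (f : Fin n → Poly) q → sumP n f *P q ≈ sumP n (λ i → f i *P q)
  sumP-*P zero    f q = ≈-refl
  sumP-*P (suc n) f q =
    ≈-trans (*P-distribʳ q (f zero) (sumP n (λ i → f (suc i))))
            (+P-cong ≈-refl (sumP-*P n (λ i → f (suc i)) q))

  sumL : ∀ {A : Set} → List A → (A → Poly) → Poly
  sumL []       w = zeroP
  sumL (x ∷ xs) w = w x +P sumL xs w

  sumL-cong : ∀ {A : Set} (xs : List A) {v w : A → Poly} → (∀ x → v x ≈ w x) → sumL xs v ≈ sumL xs w
  sumL-cong []       e = ≈-refl
  sumL-cong (x ∷ xs) e = +P-cong (e x) (sumL-cong xs e)

  sumL-++ : ∀ {A : Set} (xs ys : List A) (w : A → Poly) → sumL (xs ++ ys) w ≈ sumL xs w +P sumL ys w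
  atDegree (sumL-++ []       ys w) k = refl
  atDegree (sumL-++ (x ∷ xs) ys w) k = begin
    coeff (w x +P sumL (xs ++ ys) w) k                        ≡⟨ coeff-+P (w x) _ k ⟩
    coeff (w x) k + coeff (sumL (xs ++ ys) w) k                ≡⟨ cong (_+_ (coeff (w x) k))
                                                                     (trans (atDegree (sumL-++ xs ys w) k) (coeff-+P (sumL xs w) (sumL ys w) k)) ⟩
    coeff (w x) k + (coeff (sumL xs w) k + coeff (sumL ys w) k) ≡⟨ sym (ℤP.+-assoc (coeff (w x) k) _ _) ⟩
    coeff (w x) k + coeff (sumL xs w) k + coeff (sumL ys w) k   ≡⟨ cong (_+ coeff (sumL ys w) k)
                                                                     (sym (coeff-+P (w x) (sumL xs w) k)) ⟩
    coeff (w x +P sumL xs w) k + coeff (sumL ys w) k            ≡⟨ sym (coeff-+P (w x +P sumL xs w) _ k) ⟩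
    coeff ((w x +P sumL xs w) +P sumL ys w) k                   ∎
    where open ≡-Reasoning

  sumL-concatMap : ∀ {A B : Set} (F : A → List B) (xs : List A) (w : B → Poly) →
    sumL (concatMap F xs) w ≈ sumL xs (λ x → sumL (F x) w)
  sumL-concatMap F []       w = ≈-refl
  sumL-concatMap F (x ∷ xs) w =
    ≈-trans (sumL-++ (F x) (concatMap F xs) w) (+P-cong ≈-refl (sumL-concatMap F xs w))

  sumL-map : ∀ {A B : Set} (g : A → B) (xs : List A) (w : B → Poly) →
    sumL (map g xs) w ≡ sumL xs (λ x → w (g x))
  sumL-map g []       w = refl
  sumL-map g (x ∷ xs) w = cong (w (g x) +P_) (sumL-map g xs w)

  sumL-tabulate : ∀ {A : Set} n (g : Fin n → A) (w : A → Poly) →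
    sumL (tabulate g) w ≡ sumP n (λ i → w (g i))
  sumL-tabulate zero    g w = refl
  sumL-tabulate (suc n) g w = cong (w (g zero) +P_) (sumL-tabulate n (λ i → g (suc i)) w)

  *P-sumL : ∀ {A : Set} p (xs : List A) (w : A → Poly) → p *P sumL xs w ≈ sumL xs (λ x → p *P w x)
  *P-sumL p []       w = *P-zeroʳ p
  *P-sumL p (x ∷ xs) w = ≈-trans (*P-distribˡ p (w x) (sumL xs w)) (+P-cong ≈-refl (*P-sumL p xs w))

  coeff-sumL-monomial : ∀ {A : Set} (xs : List A) (E : A → ℕ) k →
    coeff (sumL xs (λ x → monomial (E x))) k ≡ + length (filter (λ x → E x Nat.≟ k) xs)
  coeff-sumL-monomial []       E k = refl
  coeff-sumL-monomial (x ∷ xs) E k = begin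
    coeff (monomial (E x) +P sumL xs (λ y → monomial (E y))) k
      ≡⟨ coeff-+P (monomial (E x)) _ k ⟩
    coeff (monomial (E x)) k + coeff (sumL xs (λ y → monomial (E y))) k
      ≡⟨ cong (_+_ (coeff (monomial (E x)) k)) (coeff-sumL-monomial xs E k) ⟩
    coeff (monomial (E x)) k + + length (filter hasExponent? xs)
      ≡⟨ headTerm (hasExponent? x) ⟩
    + length (filter hasExponent? (x ∷ xs))
      ∎
    where
    open ≡-Reasoning
    hasExponent? : ∀ y → Dec (E y ≡ k)
    hasExponent? y = E y Nat.≟ k
    headTerm : Dec (E x ≡ k) →
      coeff (monomial (E x)) k + + length (filter hasExponent? xs) ≡ + length (filter hasExponent? (x ∷ xs))
    headTerm (yes Ex≡k) =
      trans (cong (_+ + length (filter hasExponent? xs)) (trans (cong (λ a → coeff (monomial a) k) Ex≡k) (coeff-monomial-same k)))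
            (cong (λ l → + length l) (sym (ListP.filter-accept hasExponent? Ex≡k)))
    headTerm (no Ex≢k) =
      trans (cong (_+ + length (filter hasExponent? xs)) (coeff-monomial-other (E x) k Ex≢k))
            (trans (ℤP.+-identityˡ _) (cong (λ l → + length l) (sym (ListP.filter-reject hasExponent? Ex≢k))))

  prodP : ∀ m → (Fin m → Poly) → Poly
  prodP zero    v = oneP
  prodP (suc m) v = v zero *P prodP m (λ i → v (suc i))

  prodP-cong : ∀ m {v w : Fin m → Poly} → (∀ i → v i ≈ w i) → prodP m v ≈ prodP m w
  prodP-cong zero    e = ≈-refl
  prodP-cong (suc m) e = *P-cong (e zero) (prodP-cong m (λ i → e (suc i)))

  prodP-monomial : ∀ m (e : Fin m → ℕ) → prodP m (λ i → monomial (e i)) ≈ monomial (sumℕ m e)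
  prodP-monomial zero    e = ≈-refl
  prodP-monomial (suc m) e =
    ≈-trans (*P-congʳ (monomial (e zero)) (prodP-monomial m (λ i → e (suc i))))
            (monomial-*P (e zero) (sumℕ m (λ i → e (suc i))))

  prodP-sumP : ∀ m n (g : Fin m → Fin n → Poly) →
    prodP m (λ i → sumP n (g i)) ≈ sumL (allFuns m n) (λ h → prodP m (λ i → g i (h i)))
  prodP-sumP zero    n g = ≈-refl
  prodP-sumP (suc m) n g = begin
      sumP n (g zero) *P prodP m (λ i → sumP n (g (suc i)))
    ≈⟨ *P-congʳ (sumP n (g zero)) (prodP-sumP m n (λ i → g (suc i))) ⟩
      sumP n (g zero) *P sumL (allFuns m n) tailProduct
    ≈⟨ *P-sumL (sumP n (g zero)) (allFuns m n) tailProduct ⟩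
      sumL (allFuns m n) (λ h → sumP n (g zero) *P tailProduct h)
    ≈⟨ sumL-cong (allFuns m n) (λ h → sumP-*P n (g zero) (tailProduct h)) ⟩
      sumL (allFuns m n) (λ h → sumP n (λ a → g zero a *P tailProduct h))
    ≈⟨ sumL-cong (allFuns m n) (λ h → ≈-reflexive (sym (extensions h))) ⟩
      sumL (allFuns m n) (λ h → sumL (map (_∷ᶠ h) (allFin n)) product)
    ≈⟨ ≈-sym (sumL-concatMap (λ h → map (_∷ᶠ h) (allFin n)) (allFuns m n) product) ⟩
      sumL (allFuns (suc m) n) product
    ∎
    where
    open ≈-Reasoning
    tailProduct : (Fin m → Fin n) → Poly
    tailProduct h = prodP m (λ i → g (suc i) (h i))
    product : (Fin (suc m) → Fin n) → Poly
    product h = prodP (suc m) (λ i → g i (h i))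
    extensions : ∀ h → sumL (map (_∷ᶠ h) (allFin n)) product ≡ sumP n (λ a → g zero a *P tailProduct h)
    extensions h = trans (sumL-map (_∷ᶠ h) (allFin n) product)
                         (sumL-tabulate n (λ a → a) (λ a → product (a ∷ᶠ h)))

  -- Laplace expansion of a diagonal matrix keeps only the first term.
  det-diag : ∀ n (v : Fin n → Poly) → det n (diag v) ≈ prodP n v
  det-diag zero    v = ≈-refl
  det-diag (suc n) v = begin
      det (suc n) (diag v)
    ≈⟨ +P-cong (*P-identityˡ (v zero *P det n (diag (λ i → v (suc i)))))
               (sumP-zero n _ (λ j → *P-zeroʳ (sign (toℕ (suc j))))) ⟩
      v zero *P det n (diag (λ i → v (suc i))) +P zeroP
    ≈⟨ +P-identityʳ _ ⟩
      v zero *P det n (diag (λ i → v (suc i)))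
    ≈⟨ *P-congʳ (v zero) (det-diag n (λ i → v (suc i))) ⟩
      prodP (suc n) v
    ∎
    where open ≈-Reasoning

open SumsAndProducts

edgeLabel : ∀ {n} → (Fin n → Fin n) → Fin n → ℕ
edgeLabel h i = ∣ toℕ (h i) - toℕ i ∣

labelExponent : ∀ n → (Fin n → Fin n) → ℕ
labelExponent n h = sumℕ n (λ i → suc n ^ edgeLabel h i)

FX-expansion : ∀ n → FX n ≈ sumL (allFuns n n) (λ h → monomial (labelExponent n h))
FX-expansion n = begin
    det n (diag (mulVec (Xmat n) ones))
  ≈⟨ det-diag n (mulVec (Xmat n) ones) ⟩
    prodP n (λ i → sumP n (λ j → Xmat n i j *P oneP))
  ≈⟨ prodP-sumP n n (λ i j → Xmat n i j *P oneP) ⟩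
    sumL (allFuns n n) (λ h → prodP n (λ i → Xmat n i (h i) *P oneP))
  ≈⟨ sumL-cong (allFuns n n) (λ h → prodP-cong n (entry h)) ⟩
    sumL (allFuns n n) (λ h → prodP n (λ i → monomial (suc n ^ edgeLabel h i)))
  ≈⟨ sumL-cong (allFuns n n) (λ h → prodP-monomial n (λ i → suc n ^ edgeLabel h i)) ⟩
    sumL (allFuns n n) (λ h → monomial (labelExponent n h))
  ∎
  where
  open ≈-Reasoning
  entry : ∀ h i → Xmat n i (h i) *P oneP ≈ monomial (suc n ^ edgeLabel h i)
  entry h i = ≈-trans (*P-identityʳ (Xmat n i (h i)))
                      (≈-reflexive (cong (λ d → monomial (suc n ^ d)) (ℕP.∣-∣-comm (toℕ i) (toℕ (h i)))))

coeff-FX : ∀ n k → coeff (FX n) k ≡ + length (filter (λ h → labelExponent n h Nat.≟ k) (allFuns n n))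
coeff-FX n k = trans (atDegree (FX-expansion n) k) (coeff-sumL-monomial (allFuns n n) (labelExponent n) k)

module Weights where

  open Nat using (_+_; _*_)
  open import Data.Nat.Solver using (module +-*-Solver)
  open +-*-Solver using (solve; _:+_; _:*_; _:=_)

  weight : ℕ → List ℕ → ℕ
  weight B xs = sum (map (B ^_) xs)

  weight-↭ : ∀ B {xs ys} → xs ↭ ys → weight B xs ≡ weight B ys
  weight-↭ B p = sum-↭ (PermP.map⁺ (B ^_) p)

  weight-tabulate : ∀ B k (g : Fin k → ℕ) → weight B (tabulate g) ≡ sumℕ k (λ i → B ^ g i)
  weight-tabulate B zero    g = refl
  weight-tabulate B (suc k) g = cong (_+_ (B ^ g zero)) (weight-tabulate B k (λ i → g (suc i)))

  -- Split a list into its zeros (the lowest base-B digit of the weight)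
  -- and its nonzero entries lowered by one (the higher digits).
  zeroCount : List ℕ → ℕ
  zeroCount []            = 0
  zeroCount (zero  ∷ xs)  = suc (zeroCount xs)
  zeroCount (suc x ∷ xs)  = zeroCount xs

  lowered : List ℕ → List ℕ
  lowered []           = []
  lowered (zero  ∷ xs) = lowered xs
  lowered (suc x ∷ xs) = x ∷ lowered xs

  weight-split : ∀ B xs → weight B xs ≡ zeroCount xs + weight B (lowered xs) * B
  weight-split B []           = refl
  weight-split B (zero  ∷ xs) = cong suc (weight-split B xs)
  weight-split B (suc x ∷ xs) = begin
    B * B ^ x + weight B xs                                 ≡⟨ cong (_+_ (B * B ^ x)) (weight-split B xs) ⟩
    B * B ^ x + (zeroCount xs + weight B (lowered xs) * B)  ≡⟨ regroup B (B ^ x) (zeroCount xs) _ ⟩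
    zeroCount xs + (B ^ x + weight B (lowered xs)) * B      ∎
    where
    open ≡-Reasoning
    regroup : ∀ b p z w → b * p + (z + w * b) ≡ z + (p + w) * b
    regroup = solve 4 (λ b p z w → b :* p :+ (z :+ w :* b) := z :+ (p :+ w) :* b) refl

  zeroCount-≤ : ∀ xs → zeroCount xs ≤ length xs
  zeroCount-≤ []           = z≤n
  zeroCount-≤ (zero  ∷ xs) = s≤s (zeroCount-≤ xs)
  zeroCount-≤ (suc x ∷ xs) = ℕP.m≤n⇒m≤1+n (zeroCount-≤ xs)

  lowered-length : ∀ xs → length (lowered xs) ≤ length xs
  lowered-length []           = z≤n
  lowered-length (zero  ∷ xs) = ℕP.m≤n⇒m≤1+n (lowered-length xs)
  lowered-length (suc x ∷ xs) = s≤s (lowered-length xs)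

  lowered-bounded : ∀ {m xs} → All (_< suc m) xs → All (_< m) (lowered xs)
  lowered-bounded {xs = []}         []              = []
  lowered-bounded {xs = zero  ∷ xs} (_ ∷ xs<)       = lowered-bounded xs<
  lowered-bounded {xs = suc x ∷ xs} (s≤s x<m ∷ xs<) = x<m ∷ lowered-bounded xs<

  lowered-sorted : ∀ {xs} → Linked _≤_ xs → Linked _≤_ (lowered xs)
  lowered-sorted {[]}                _               = []
  lowered-sorted {zero  ∷ xs}        l               = lowered-sorted (Linked.tail l)
  lowered-sorted {suc x ∷ []}        _               = [-]
  lowered-sorted {suc x ∷ zero ∷ xs} (() ∷ _)
  lowered-sorted {suc x ∷ suc y ∷ xs} (s≤s x≤y ∷ l) = x≤y ∷ lowered-sorted l

  positive-lowered : ∀ {xs} → All (1 ≤_) xs → zeroCount xs ≡ 0 × map suc (lowered xs) ≡ xs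
  positive-lowered []                    = refl , refl
  positive-lowered {suc x ∷ xs} (_ ∷ ps) =
    proj₁ (positive-lowered ps) , cong (suc x ∷_) (proj₂ (positive-lowered ps))

  sorted-split : ∀ {xs} → Linked _≤_ xs → xs ≡ replicate (zeroCount xs) 0 ++ map suc (lowered xs)
  sorted-split {[]}         _ = refl
  sorted-split {zero  ∷ xs} l = cong (0 ∷_) (sorted-split (Linked.tail l))
  sorted-split {suc x ∷ xs} l =
    trans (sym (proj₂ positive)) (cong (λ z → replicate z 0 ++ map suc (lowered (suc x ∷ xs))) (sym (proj₁ positive)))
    where
    positive : zeroCount (suc x ∷ xs) ≡ 0 × map suc (lowered (suc x ∷ xs)) ≡ suc x ∷ xs
    positive = positive-lowered (Linked⇒All ℕP.≤-trans (s≤s z≤n) l)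

  digit-unique : ∀ B .{{_ : NonZero B}} {a c x y} → a < B → c < B →
    a + x * B ≡ c + y * B → a ≡ c × x ≡ y
  digit-unique B {a} {c} {x} {y} a<B c<B e =
    a≡c , ℕP.*-cancelʳ-≡ x y B (ℕP.+-cancelˡ-≡ a _ _ (trans e (cong (_+ y * B) (sym a≡c))))
    where
    a≡c : a ≡ c
    a≡c = begin
      a                ≡⟨ sym (m<n⇒m%n≡m a<B) ⟩
      a % B            ≡⟨ sym ([m+kn]%n≡m%n a x B) ⟩
      (a + x * B) % B  ≡⟨ cong (_% B) e ⟩
      (c + y * B) % B  ≡⟨ [m+kn]%n≡m%n c y B ⟩
      c % B            ≡⟨ m<n⇒m%n≡m c<B ⟩
      c                ∎
      where open ≡-Reasoning

  weight-injective : ∀ b m {xs ys} → Linked _≤_ xs → Linked _≤_ ys → All (_< m) xs → All (_< m) ys →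
    length xs ≤ b → length ys ≤ b → weight (suc b) xs ≡ weight (suc b) ys → xs ≡ ys
  weight-injective b zero    {[]}     {[]}     _ _ _        _        _ _ _ = refl
  weight-injective b zero    {x ∷ xs}          _ _ (() ∷ _) _        _ _ _
  weight-injective b zero    {[]}     {y ∷ ys} _ _ _        (() ∷ _) _ _ _
  weight-injective b (suc m) {xs}     {ys} xs↗ ys↗ xs<m ys<m xs≤b ys≤b e = begin
    xs                                                  ≡⟨ sorted-split xs↗ ⟩
    replicate (zeroCount xs) 0 ++ map suc (lowered xs)  ≡⟨ cong₂ (λ z l → replicate z 0 ++ map suc l)
                                                                 (proj₁ digits) higherDigits ⟩
    replicate (zeroCount ys) 0 ++ map suc (lowered ys)  ≡⟨ sym (sorted-split ys↗) ⟩
    ys                                                  ∎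
    where
    open ≡-Reasoning
    digits : zeroCount xs ≡ zeroCount ys × weight (suc b) (lowered xs) ≡ weight (suc b) (lowered ys)
    digits = digit-unique (suc b)
      (s≤s (ℕP.≤-trans (zeroCount-≤ xs) xs≤b)) (s≤s (ℕP.≤-trans (zeroCount-≤ ys) ys≤b))
      (trans (sym (weight-split (suc b) xs)) (trans e (weight-split (suc b) ys)))
    higherDigits : lowered xs ≡ lowered ys
    higherDigits = weight-injective b m (lowered-sorted xs↗) (lowered-sorted ys↗)
      (lowered-bounded xs<m) (lowered-bounded ys<m)
      (ℕP.≤-trans (lowered-length xs) xs≤b) (ℕP.≤-trans (lowered-length ys) ys≤b) (proj₂ digits)

open Weights

-- The entries of a vector over Fin m, read as naturals (seqList is the case m = k = n).
entries : ∀ {m k} → Vec (Fin m) k → List ℕ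
entries s = Vec.toList (Vec.map toℕ s)

entries-weight : ∀ B {m k} (s : Vec (Fin m) k) → weight B (entries s) ≡ sumℕ k (λ i → B ^ toℕ (lookup s i))
entries-weight B []      = refl
entries-weight B (x ∷ s) = cong (Nat._+_ (B ^ toℕ x)) (entries-weight B s)

entries-length : ∀ {m k} (s : Vec (Fin m) k) → length (entries s) ≡ k
entries-length []      = refl
entries-length (x ∷ s) = cong suc (entries-length s)

entries-bounded : ∀ {m k} (s : Vec (Fin m) k) → All (_< m) (entries s)
entries-bounded []      = []
entries-bounded (x ∷ s) = FinP.toℕ<n x ∷ entries-bounded s

entries-sorted : ∀ {m k} (s : Vec (Fin m) k) →
  (∀ (i j : Fin k) → i Fin.≤ j → lookup s i Fin.≤ lookup s j) → Linked _≤_ (entries s)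
entries-sorted []          mono = []
entries-sorted (x ∷ [])    mono = [-]
entries-sorted (x ∷ y ∷ s) mono =
  mono zero (suc zero) z≤n ∷ entries-sorted (y ∷ s) (λ i j i≤j → mono (suc i) (suc j) (s≤s i≤j))

entries-injective : ∀ {m k} (s t : Vec (Fin m) k) → entries s ≡ entries t → s ≡ t
entries-injective []      []      e = refl
entries-injective (x ∷ s) (y ∷ t) e =
  cong₂ _∷_ (FinP.toℕ-injective (ListP.∷-injectiveˡ e)) (entries-injective s t (ListP.∷-injectiveʳ e))

-- Edge labels are digits in base n+1: |h(i) - i| < n.
edgeLabel-bound : ∀ {n} (h : Fin n → Fin n) i → edgeLabel h i < n
edgeLabel-bound h i = ℕP.≤-<-trans (ℕP.∣m-n∣≤m⊔n (toℕ (h i)) (toℕ i))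
                                   (ℕP.⊔-lub (FinP.toℕ<n (h i)) (FinP.toℕ<n i))

labelSeq-↭ : ∀ {n} (h : Fin n → Fin n) → labelSeq h ↭ map (edgeLabel h) (allFin n)
labelSeq-↭ {n} h = sort-↭ (map (edgeLabel h) (allFin n))

labelSeq-weight : ∀ n (h : Fin n → Fin n) → weight (suc n) (labelSeq h) ≡ labelExponent n h
labelSeq-weight n h = begin
  weight (suc n) (labelSeq h)                         ≡⟨ weight-↭ (suc n) (labelSeq-↭ h) ⟩
  weight (suc n) (map (edgeLabel h) (allFin n))       ≡⟨ cong (weight (suc n)) (ListP.map-tabulate (λ i → i) (edgeLabel h)) ⟩
  weight (suc n) (tabulate (edgeLabel h))             ≡⟨ weight-tabulate (suc n) n (edgeLabel h) ⟩
  labelExponent n h                                   ∎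
  where open ≡-Reasoning

labelSeq-bounded : ∀ {n} (h : Fin n → Fin n) → All (_< n) (labelSeq h)
labelSeq-bounded {n} h =
  PermP.All-resp-↭ (↭-sym (labelSeq-↭ h)) (AllP.map⁺ (AllP.tabulate⁺ (edgeLabel-bound h)))

labelSeq-length : ∀ {n} (h : Fin n → Fin n) → length (labelSeq h) ≡ n
labelSeq-length {n} h =
  trans (PermP.↭-length (labelSeq-↭ h)) (trans (ListP.length-map (edgeLabel h) (allFin n)) (ListP.length-tabulate (λ i → i)))

expo-injective : ∀ n (s t : Vec (Fin n) n) → NonDecreasing s → NonDecreasing t → expo s ≡ expo t → s ≡ t
expo-injective n s t s↗ t↗ e =
  entries-injective s t
    (weight-injective n n (entries-sorted s s↗) (entries-sorted t t↗) (entries-bounded s) (entries-bounded t)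
      (ℕP.≤-reflexive (entries-length s)) (ℕP.≤-reflexive (entries-length t))
      (trans (entries-weight (suc n) s) (trans e (sym (entries-weight (suc n) t)))))

exponent-of-labelSeq : ∀ n (h : Fin n → Fin n) (s : Vec (Fin n) n) →
  labelSeq h ≡ seqList s → labelExponent n h ≡ expo s
exponent-of-labelSeq n h s e =
  trans (sym (labelSeq-weight n h)) (trans (cong (weight (suc n)) e) (entries-weight (suc n) s))

labelSeq-of-exponent : ∀ n (h : Fin n → Fin n) (s : Vec (Fin n) n) → NonDecreasing s →
  labelExponent n h ≡ expo s → labelSeq h ≡ seqList s
labelSeq-of-exponent n h s s↗ e =
  weight-injective n n (sort-↗ _) (entries-sorted s s↗) (labelSeq-bounded h) (entries-bounded s)
    (ℕP.≤-reflexive (labelSeq-length h)) (ℕP.≤-reflexive (entries-length s))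
    (trans (labelSeq-weight n h) (trans e (sym (entries-weight (suc n) s))))

-- Part one is expo-injective; part two reads the coefficient off coeff-FX and
-- replaces the condition E(h) = e(s) by labelSeq h = s.
corollary3p2 : (n : ℕ) → 1 ≤ n →
    ((s t : Vec (Fin n) n) → NonDecreasing s → NonDecreasing t →
       expo s ≡ expo t → s ≡ t)
    × ((s : Vec (Fin n) n) → NonDecreasing s →
       coeff (FX n) (expo s) ≡ + (countFuns n s))
corollary3p2 n _ = expo-injective n , coefficient
  where
  coefficient : (s : Vec (Fin n) n) → NonDecreasing s → coeff (FX n) (expo s) ≡ + (countFuns n s)
  coefficient s s↗ = begin
    coeff (FX n) (expo s)
      ≡⟨ coeff-FX n (expo s) ⟩
    + length (filter (λ h → labelExponent n h Nat.≟ expo s) (allFuns n n))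
      ≡⟨ cong (λ l → + length l)
              (ListP.filter-≐ (λ h → labelExponent n h Nat.≟ expo s)
                              (λ h → ListP.≡-dec Nat._≟_ (labelSeq h) (seqList s))
                              ((λ {h} → labelSeq-of-exponent n h s s↗) , (λ {h} → exponent-of-labelSeq n h s))
                              (allFuns n n)) ⟩
    + countFuns n s
      ∎
    where open ≡-Reasoning
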